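{- Let $T^-,T'^-\in\Omega^-$, $T^+,T'^+\in\Omega^+$, and let $X$ be a predicate variable or predicate symbol. (1) If $X$ is positive (resp. negative) in $T^-$, then $T^-[T'^-/X]\in\Omega^-$ (resp. $T^-[T'^+/X]\in\Omega^-$). (2) If $X$ is positive (resp. negative) in $T^+$, then $T^+[T'^+/X]\in\Omega^+$ (resp. $T^+[T'^-/X]\in\Omega^+$). (3) For any formulas $T,F$: if $T[F/X]\in\Omega^+$ (resp. $T[F/X]\in\Omega^-$), then $T\in\Omega^+$ (resp. $T\in\Omega^-$).
   Context: Formulas. Second-order language with individual variables, function symbols (building terms), predicate symbols and predicate variables of every arity, logical symbols $\perp,\rightarrow,\forall,\mu$. Formulas: $\perp$; atomic $X(t_1,\dots,t_n)$; $A\rightarrow B$; $\forall xA$; $\forall XA$; $\mu Cx_1\dots x_nA\langle t_1,\dots,t_n\rangle$ with $C$ an $n$-ary predicate symbol appearing and positive in $A$ ($C,\bar x$ bound). Positivity of $X$ in $A$: if $X$ does not appear in $A$, both positive and negative; in $X(\bar t)$: positive, not negative; in $B\rightarrow C$: positive (negative) iff negative (positive) in $B$ and positive (negative) in $C$; in $\forall vB$ ($v\ne X$) and $\mu C\bar xB\langle\bar t\rangle$: as in $B$. For $X$ $n$-ary, $A[G/X]$ abbreviates $A[G/X(x_1,\dots,x_n)]$: replace each atomic $X(t_1,\dots,t_n)$ in $A$ by $G[t_1/x_1,\dots,t_n/x_n]$ (renaming bound variables). $\Omega^+$, $\Omega^-$: least sets with atomic formulas and $\perp$ in both; $T^-\rightarrow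 T^+\in\Omega^+$ and $T^+\rightarrow T^-\in\Omega^-$ for $T^\pm\in\Omega^\pm$; $\forall xT^+,\forall XT^+\in\Omega^+$; $\forall xT^-\in\Omega^-$; $\forall XT^-\in\Omega^-$ if $X$ not free in $T^-$; $\mu Cx_1\dots x_nT^+\langle\bar t\rangle\in\Omega^+$ if $C$ appears and is positive in $T^+$. -}

module Defs where

open import Data.Nat using (ℕ; zero; suc; _+_)
open import Data.Nat.Properties using (_≟_)
open import Data.Vec using (Vec; []; _∷_; tabulate)
open import Data.Fin using (toℕ)
open import Data.Bool using (Bool; true; false; if_then_else_; _∧_)
open import Relation.Nullary using (¬_)
open import Relation.Nullary.Decidable using (⌊_⌋)

-- Syntax (de Bruijn indices for all bindable names, so that
-- substitution is automatically capture-avoiding, i.e. "renaming bound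
-- variables" is built in).

data Term : Set where
  var : ℕ → Term
  fun : (n f : ℕ) → Vec Term n → Term

-- Predicate names: predicate variables (bound by ∀) and predicate symbols
-- (bound by μ); each sort (kind, arity) has its own de Bruijn indices.
data Kind : Set where
  pvar psym : Kind

data PName : Set where
  pn : Kind → (arity : ℕ) → (index : ℕ) → PName

arity : PName → ℕ
arity (pn _ n _) = n

data Formula : Set where
  ⊥ᶠ   : Formula
  atom : (X : PName) → Vec Term (arity X) → Formula
  _⇒_  : Formula → Formula → Formula
  ∀ᵢ   : Formula → Formula
  ∀ₚ   : (n : ℕ) → Formula → Formula        -- ∀X A   (binds pn pvar n 0)
  μ    : (n : ℕ) → Formula → Vec Term n → Formula
  -- μ C x₁…xₙ A ⟨t₁…tₙ⟩ : in A, pn psym n 0 is C and individual indices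
  -- 0 … n-1 are x₁ … xₙ; the terms tᵢ live outside the binder.

infixr 5 _⇒_

mutual
  substT : (ℕ → Term) → Term → Term
  substT σ (var i) = σ i
  substT σ (fun n f ts) = fun n f (substTs σ ts)

  substTs : ∀ {n} → (ℕ → Term) → Vec Term n → Vec Term n
  substTs σ [] = []
  substTs σ (t ∷ ts) = substT σ t ∷ substTs σ ts

lift1 : (ℕ → Term) → ℕ → Term
lift1 σ zero = var zero
lift1 σ (suc i) = substT (λ j → var (suc j)) (σ i)

liftσ : ℕ → (ℕ → Term) → ℕ → Term
liftσ zero σ = σ
liftσ (suc k) σ = lift1 (liftσ k σ)

substF : (ℕ → Term) → Formula → Formula
substF σ ⊥ᶠ = ⊥ᶠ
substF σ (atom X ts) = atom X (substTs σ ts)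
substF σ (A ⇒ B) = substF σ A ⇒ substF σ B
substF σ (∀ᵢ A) = ∀ᵢ (substF (lift1 σ) A)
substF σ (∀ₚ n A) = ∀ₚ n (substF σ A)
substF σ (μ n A ts) = μ n (substF (liftσ n σ) A) (substTs σ ts)

_≟K_ : Kind → Kind → Bool
pvar ≟K pvar = true
psym ≟K psym = true
_    ≟K _    = false

same : Kind → ℕ → Kind → ℕ → Bool
same κ m κ' m' = (κ ≟K κ') ∧ ⌊ m ≟ m' ⌋

PRen : Set
PRen = Kind → ℕ → ℕ → ℕ

wkR : Kind → ℕ → PRen
wkR κ m κ' m' k = if same κ m κ' m' then suc k else k

liftIdx : (ℕ → ℕ) → ℕ → ℕ
liftIdx r zero = zero
liftIdx r (suc k) = suc (r k)

liftR : Kind → ℕ → PRen → PRen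
liftR κ m r κ' m' k = if same κ m κ' m' then liftIdx (r κ' m') k else r κ' m' k

renP : PRen → Formula → Formula
renP r ⊥ᶠ = ⊥ᶠ
renP r (atom (pn κ n k) ts) = atom (pn κ n (r κ n k)) ts
renP r (A ⇒ B) = renP r A ⇒ renP r B
renP r (∀ᵢ A) = ∀ᵢ (renP r A)
renP r (∀ₚ n A) = ∀ₚ n (renP (liftR pvar n r) A)
renP r (μ n A ts) = μ n (renP (liftR psym n r) A) ts

wkN : Kind → ℕ → PName → PName
wkN κ m (pn κ' m' k) = pn κ' m' (wkR κ m κ' m' k)

-- A replacement for an n-ary name is a formula G whose individual
-- indices 0 … n-1 play the role of x₁ … xₙ (the remaining indices are
-- the free variables of G, shifted by n).

params : (n : ℕ) → Vec Term n
params n = tabulate (λ i → var (toℕ i))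

inst : ∀ {n} → Vec Term n → ℕ → Term
inst [] i = var i
inst (t ∷ ts) zero = t
inst (t ∷ ts) (suc i) = inst ts i

PSub : Set
PSub = Kind → (n : ℕ) → ℕ → Formula

liftInd : ℕ → PSub → PSub
liftInd d ρ κ n k = substF (liftσ n (λ i → var (d + i))) (ρ κ n k)

liftPredIdx : Kind → ℕ → PSub → Kind → (n : ℕ) → ℕ → Formula
liftPredIdx κb m ρ κ n zero = atom (pn κ n zero) (params n)
liftPredIdx κb m ρ κ n (suc k) = renP (wkR κb m) (ρ κ n k)

liftPred : Kind → ℕ → PSub → PSub
liftPred κb m ρ κ n k =
  if same κb m κ n then liftPredIdx κb m ρ κ n k else renP (wkR κb m) (ρ κ n k)

substP : PSub → Formula → Formula
substP ρ ⊥ᶠ = ⊥ᶠ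
substP ρ (atom (pn κ n k) ts) = substF (inst ts) (ρ κ n k)
substP ρ (A ⇒ B) = substP ρ A ⇒ substP ρ B
substP ρ (∀ᵢ A) = ∀ᵢ (substP (liftInd 1 ρ) A)
substP ρ (∀ₚ m A) = ∀ₚ m (substP (liftPred pvar m ρ) A)
substP ρ (μ n A ts) = μ n (substP (liftInd n (liftPred psym n ρ)) A) ts

single : PName → Formula → PSub
single (pn κ n k) G κ' n' k' =
  if same κ n κ' n' ∧ ⌊ k ≟ k' ⌋ then G else atom (pn κ' n' k') (params n')

_[_/_] : Formula → Formula → PName → Formula
A [ G / X ] = substP (single X G) A

data Occurs : PName → Formula → Set where
  here : ∀ {X ts} → Occurs X (atom X ts)
  ⇒ˡ   : ∀ {X A B} → Occurs X A → Occurs X (A ⇒ B)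
  ⇒ʳ   : ∀ {X A B} → Occurs X B → Occurs X (A ⇒ B)
  ∀ᵢo  : ∀ {X A} → Occurs X A → Occurs X (∀ᵢ A)
  ∀ₚo  : ∀ {X n A} → Occurs (wkN pvar n X) A → Occurs X (∀ₚ n A)
  μo   : ∀ {X n A ts} → Occurs (wkN psym n X) A → Occurs X (μ n A ts)

mutual
  data Pos : PName → Formula → Set where
    pos-no   : ∀ {X A} → ¬ Occurs X A → Pos X A
    pos-atom : ∀ {X ts} → Pos X (atom X ts)
    pos-⇒    : ∀ {X A B} → Neg X A → Pos X B → Pos X (A ⇒ B)
    pos-∀ᵢ   : ∀ {X A} → Pos X A → Pos X (∀ᵢ A)
    pos-∀ₚ   : ∀ {X n A} → Pos (wkN pvar n X) A → Pos X (∀ₚ n A)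
    pos-μ    : ∀ {X n A ts} → Pos (wkN psym n X) A → Pos X (μ n A ts)

  data Neg : PName → Formula → Set where
    neg-no   : ∀ {X A} → ¬ Occurs X A → Neg X A
    neg-⇒    : ∀ {X A B} → Pos X A → Neg X B → Neg X (A ⇒ B)
    neg-∀ᵢ   : ∀ {X A} → Neg X A → Neg X (∀ᵢ A)
    neg-∀ₚ   : ∀ {X n A} → Neg (wkN pvar n X) A → Neg X (∀ₚ n A)
    neg-μ    : ∀ {X n A ts} → Neg (wkN psym n X) A → Neg X (μ n A ts)

data WF : Formula → Set where
  wf-⊥    : WF ⊥ᶠ
  wf-atom : ∀ {X ts} → WF (atom X ts)
  wf-⇒    : ∀ {A B} → WF A → WF B → WF (A ⇒ B)
  wf-∀ᵢ   : ∀ {A} → WF A → WF (∀ᵢ A)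
  wf-∀ₚ   : ∀ {n A} → WF A → WF (∀ₚ n A)
  wf-μ    : ∀ {n A ts} → Occurs (pn psym n zero) A → Pos (pn psym n zero) A
          → WF A → WF (μ n A ts)

mutual
  data Ω⁺ : Formula → Set where
    Ω⁺-atom : ∀ {X ts} → Ω⁺ (atom X ts)
    Ω⁺-⊥    : Ω⁺ ⊥ᶠ
    Ω⁺-⇒    : ∀ {A B} → Ω⁻ A → Ω⁺ B → Ω⁺ (A ⇒ B)
    Ω⁺-∀ᵢ   : ∀ {A} → Ω⁺ A → Ω⁺ (∀ᵢ A)
    Ω⁺-∀ₚ   : ∀ {n A} → Ω⁺ A → Ω⁺ (∀ₚ n A)
    Ω⁺-μ    : ∀ {n A ts} → Occurs (pn psym n zero) A → Pos (pn psym n zero) A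
            → Ω⁺ A → Ω⁺ (μ n A ts)

  data Ω⁻ : Formula → Set where
    Ω⁻-atom : ∀ {X ts} → Ω⁻ (atom X ts)
    Ω⁻-⊥    : Ω⁻ ⊥ᶠ
    Ω⁻-⇒    : ∀ {A B} → Ω⁺ A → Ω⁻ B → Ω⁻ (A ⇒ B)
    Ω⁻-∀ᵢ   : ∀ {A} → Ω⁻ A → Ω⁻ (∀ᵢ A)
    Ω⁻-∀ₚ   : ∀ {n A} → ¬ Occurs (pn pvar n zero) A → Ω⁻ A → Ω⁻ (∀ₚ n A)

module Submission where

-- Parts (1) and (2) are proved simultaneously, for an arbitrary simultaneous
-- substitution ρ of formulas for predicate names that is "atomic except at X":
-- every name other than X is sent to an atomic formula, and X is sent to an
-- atom or to a formula of the required class.  Such substitutions are closed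
-- under going below binders, so one mutual induction over the Ω-derivation of
-- T (four cases: T ∈ Ω⁻ / Ω⁺, X positive / negative) does all the work; the
-- single substitution T [ T' / X ] is the special case ρ = single X T'.  The side conditions of Ω⁺-μ and Ω⁻-∀ₚ concern
-- the freshly bound name, which a lifted substitution fixes and which no
-- other image mentions; such names keep their occurrences and polarity.
-- Part (3) holds for every substitution: substP only changes atoms, and every
-- atom lies in both classes, so membership of the result reflects back to T.

open import Defs
open import Data.Nat using (ℕ; zero; suc)
open import Data.Nat.Properties using (_≟_; suc-injective)
open import Data.Bool using (true; false)
open import Data.Product using (Σ; _×_; _,_; proj₁; proj₂)
open import Data.Sum using (_⊎_; inj₁; inj₂)
open import Data.Empty using (⊥-elim)
open import Data.Vec using (Vec)
open import Relation.Nullary using (¬_; yes; no)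
open import Relation.Nullary.Decidable using (dec-true; dec-false; isYes≗does)
open import Relation.Binary.PropositionalEquality
  using (_≡_; _≢_; refl; sym; trans; cong; subst)

-- Sorts of names.  A binder of sort (κ , m) shifts exactly the indices of
-- its own sort; most bookkeeping lemmas are a case split on `same`.

same-refl : ∀ κ m → same κ m κ m ≡ true
same-refl pvar m = trans (isYes≗does (m ≟ m)) (dec-true (m ≟ m) refl)
same-refl psym m = trans (isYes≗does (m ≟ m)) (dec-true (m ≟ m) refl)

data SortView (κ : Kind) (m : ℕ) : Kind → ℕ → Set where
  same-sort  : SortView κ m κ m
  other-sort : ∀ {κ' m'} → same κ m κ' m' ≡ false → SortView κ m κ' m'

sortView : ∀ κ m κ' m' → SortView κ m κ' m'
sortView pvar m pvar m' with m ≟ m'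
... | yes refl = same-sort
... | no m≢m' = other-sort (trans (isYes≗does (m ≟ m')) (dec-false (m ≟ m') m≢m'))
sortView psym m psym m' with m ≟ m'
... | yes refl = same-sort
... | no m≢m' = other-sort (trans (isYes≗does (m ≟ m')) (dec-false (m ≟ m') m≢m'))
sortView pvar m psym m' = other-sort refl
sortView psym m pvar m' = other-sort refl

wkR-same : ∀ κ m k → wkR κ m κ m k ≡ suc k
wkR-same κ m k rewrite same-refl κ m = refl

wkR-other : ∀ κ m κ' m' k → same κ m κ' m' ≡ false → wkR κ m κ' m' k ≡ k
wkR-other κ m κ' m' k e rewrite e = refl

InjectiveAt : PRen → Kind → ℕ → ℕ → Set
InjectiveAt r κ m j = ∀ k → r κ m k ≡ r κ m j → k ≡ j

inj-wkR : ∀ κb n κ m j → InjectiveAt (wkR κb n) κ m j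
inj-wkR κb n κ m j k eq with same κb n κ m
... | true = suc-injective eq
... | false = eq

liftR-wkR : ∀ κb n r κ m j → liftR κb n r κ m (wkR κb n κ m j) ≡ wkR κb n κ m (r κ m j)
liftR-wkR κb n r κ m j with same κb n κ m
... | true = refl
... | false = refl

liftR-wkR-inv : ∀ κb n r κ m i j → liftR κb n r κ m j ≡ wkR κb n κ m i
              → Σ ℕ λ j' → r κ m j' ≡ i × j ≡ wkR κb n κ m j'
liftR-wkR-inv κb n r κ m i j eq with same κb n κ m
liftR-wkR-inv κb n r κ m i zero () | true
liftR-wkR-inv κb n r κ m i (suc j) eq | true = j , suc-injective eq , refl
liftR-wkR-inv κb n r κ m i j eq | false = j , eq , refl

liftR-fresh : ∀ κ n r → liftR κ n r κ n 0 ≡ 0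
liftR-fresh κ n r rewrite same-refl κ n = refl

inj-fresh : ∀ κ n r → InjectiveAt (liftR κ n r) κ n 0
inj-fresh κ n r zero _ = refl
inj-fresh κ n r (suc k) eq with same κ n κ n | same-refl κ n
inj-fresh κ n r (suc k) () | .true | refl

inj-liftR : ∀ κb n r κ m j → InjectiveAt r κ m j
          → InjectiveAt (liftR κb n r) κ m (wkR κb n κ m j)
inj-liftR κb n r κ m j inj k eq
  with liftR-wkR-inv κb n r κ m (r κ m j) k (trans eq (liftR-wkR κb n r κ m j))
... | k' , rk'≡rj , refl = cong (wkR κb n κ m) (inj k' rk'≡rj)

ren-occ-inv : ∀ r B κ m i → Occurs (pn κ m i) (renP r B)
            → Σ ℕ λ j → r κ m j ≡ i × Occurs (pn κ m j) B
ren-occ-inv r ⊥ᶠ κ m i ()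
ren-occ-inv r (atom (pn _ _ k) ts) κ m i here = k , refl , here
ren-occ-inv r (A ⇒ B) κ m i (⇒ˡ o) with ren-occ-inv r A κ m i o
... | j , e , o' = j , e , ⇒ˡ o'
ren-occ-inv r (A ⇒ B) κ m i (⇒ʳ o) with ren-occ-inv r B κ m i o
... | j , e , o' = j , e , ⇒ʳ o'
ren-occ-inv r (∀ᵢ A) κ m i (∀ᵢo o) with ren-occ-inv r A κ m i o
... | j , e , o' = j , e , ∀ᵢo o'
ren-occ-inv r (∀ₚ n A) κ m i (∀ₚo o)
  with ren-occ-inv (liftR pvar n r) A κ m (wkR pvar n κ m i) o
... | j , e , o' with liftR-wkR-inv pvar n r κ m i j e
... | j' , e' , refl = j' , e' , ∀ₚo o'
ren-occ-inv r (μ n A ts) κ m i (μo o)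
  with ren-occ-inv (liftR psym n r) A κ m (wkR psym n κ m i) o
... | j , e , o' with liftR-wkR-inv psym n r κ m i j e
... | j' , e' , refl = j' , e' , μo o'

ren-occ : ∀ r B κ m j → Occurs (pn κ m j) B → Occurs (pn κ m (r κ m j)) (renP r B)
ren-occ r (atom _ ts) κ m j here = here
ren-occ r (A ⇒ B) κ m j (⇒ˡ o) = ⇒ˡ (ren-occ r A κ m j o)
ren-occ r (A ⇒ B) κ m j (⇒ʳ o) = ⇒ʳ (ren-occ r B κ m j o)
ren-occ r (∀ᵢ A) κ m j (∀ᵢo o) = ∀ᵢo (ren-occ r A κ m j o)
ren-occ r (∀ₚ n A) κ m j (∀ₚo o) =
  ∀ₚo (subst (λ x → Occurs (pn κ m x) (renP (liftR pvar n r) A)) (liftR-wkR pvar n r κ m j)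
        (ren-occ (liftR pvar n r) A κ m (wkR pvar n κ m j) o))
ren-occ r (μ n A ts) κ m j (μo o) =
  μo (subst (λ x → Occurs (pn κ m x) (renP (liftR psym n r) A)) (liftR-wkR psym n r κ m j)
        (ren-occ (liftR psym n r) A κ m (wkR psym n κ m j) o))

ren-nocc : ∀ r B κ m j → InjectiveAt r κ m j
         → ¬ Occurs (pn κ m j) B → ¬ Occurs (pn κ m (r κ m j)) (renP r B)
ren-nocc r B κ m j inj ¬o o with ren-occ-inv r B κ m (r κ m j) o
... | k , e , o' = ¬o (subst (λ x → Occurs (pn κ m x) B) (inj k e) o')

mutual
  ren-pos : ∀ r B κ m j → InjectiveAt r κ m j
          → Pos (pn κ m j) B → Pos (pn κ m (r κ m j)) (renP r B)
  ren-pos r B κ m j inj (pos-no ¬o) = pos-no (ren-nocc r B κ m j inj ¬o)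
  ren-pos r (atom _ ts) κ m j inj pos-atom = pos-atom
  ren-pos r (A ⇒ B) κ m j inj (pos-⇒ a b) =
    pos-⇒ (ren-neg r A κ m j inj a) (ren-pos r B κ m j inj b)
  ren-pos r (∀ᵢ A) κ m j inj (pos-∀ᵢ a) = pos-∀ᵢ (ren-pos r A κ m j inj a)
  ren-pos r (∀ₚ n A) κ m j inj (pos-∀ₚ a) =
    pos-∀ₚ (subst (λ x → Pos (pn κ m x) (renP (liftR pvar n r) A)) (liftR-wkR pvar n r κ m j)
      (ren-pos (liftR pvar n r) A κ m (wkR pvar n κ m j) (inj-liftR pvar n r κ m j inj) a))
  ren-pos r (μ n A ts) κ m j inj (pos-μ a) =
    pos-μ (subst (λ x → Pos (pn κ m x) (renP (liftR psym n r) A)) (liftR-wkR psym n r κ m j)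
      (ren-pos (liftR psym n r) A κ m (wkR psym n κ m j) (inj-liftR psym n r κ m j inj) a))

  ren-neg : ∀ r B κ m j → InjectiveAt r κ m j
          → Neg (pn κ m j) B → Neg (pn κ m (r κ m j)) (renP r B)
  ren-neg r B κ m j inj (neg-no ¬o) = neg-no (ren-nocc r B κ m j inj ¬o)
  ren-neg r (A ⇒ B) κ m j inj (neg-⇒ a b) =
    neg-⇒ (ren-pos r A κ m j inj a) (ren-neg r B κ m j inj b)
  ren-neg r (∀ᵢ A) κ m j inj (neg-∀ᵢ a) = neg-∀ᵢ (ren-neg r A κ m j inj a)
  ren-neg r (∀ₚ n A) κ m j inj (neg-∀ₚ a) =
    neg-∀ₚ (subst (λ x → Neg (pn κ m x) (renP (liftR pvar n r) A)) (liftR-wkR pvar n r κ m j)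
      (ren-neg (liftR pvar n r) A κ m (wkR pvar n κ m j) (inj-liftR pvar n r κ m j inj) a))
  ren-neg r (μ n A ts) κ m j inj (neg-μ a) =
    neg-μ (subst (λ x → Neg (pn κ m x) (renP (liftR psym n r) A)) (liftR-wkR psym n r κ m j)
      (ren-neg (liftR psym n r) A κ m (wkR psym n κ m j) (inj-liftR psym n r κ m j inj) a))

-- Ω⁺ and Ω⁻ are closed under renaming.  The side conditions on the name bound
-- by μ / ∀ₚ survive because lifted renamings fix it injectively.
mutual
  ren-Ω⁺ : ∀ r {B} → Ω⁺ B → Ω⁺ (renP r B)
  ren-Ω⁺ r (Ω⁺-atom {pn κ n k}) = Ω⁺-atom
  ren-Ω⁺ r Ω⁺-⊥ = Ω⁺-⊥
  ren-Ω⁺ r (Ω⁺-⇒ a b) = Ω⁺-⇒ (ren-Ω⁻ r a) (ren-Ω⁺ r b)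
  ren-Ω⁺ r (Ω⁺-∀ᵢ a) = Ω⁺-∀ᵢ (ren-Ω⁺ r a)
  ren-Ω⁺ r (Ω⁺-∀ₚ {n} a) = Ω⁺-∀ₚ (ren-Ω⁺ (liftR pvar n r) a)
  ren-Ω⁺ r (Ω⁺-μ {n} {A} o p a) =
    Ω⁺-μ (subst (λ x → Occurs (pn psym n x) (renP r' A)) (liftR-fresh psym n r)
            (ren-occ r' A psym n 0 o))
         (subst (λ x → Pos (pn psym n x) (renP r' A)) (liftR-fresh psym n r)
            (ren-pos r' A psym n 0 (inj-fresh psym n r) p))
         (ren-Ω⁺ r' a)
    where
    r' : PRen
    r' = liftR psym n r

  ren-Ω⁻ : ∀ r {B} → Ω⁻ B → Ω⁻ (renP r B)
  ren-Ω⁻ r (Ω⁻-atom {pn κ n k}) = Ω⁻-atom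
  ren-Ω⁻ r Ω⁻-⊥ = Ω⁻-⊥
  ren-Ω⁻ r (Ω⁻-⇒ a b) = Ω⁻-⇒ (ren-Ω⁺ r a) (ren-Ω⁻ r b)
  ren-Ω⁻ r (Ω⁻-∀ᵢ a) = Ω⁻-∀ᵢ (ren-Ω⁻ r a)
  ren-Ω⁻ r (Ω⁻-∀ₚ {n} {A} ¬o a) =
    Ω⁻-∀ₚ (subst (λ x → ¬ Occurs (pn pvar n x) (renP r' A)) (liftR-fresh pvar n r)
             (ren-nocc r' A pvar n 0 (inj-fresh pvar n r) ¬o))
          (ren-Ω⁻ r' a)
    where
    r' : PRen
    r' = liftR pvar n r

-- Substitution of terms for individual variables leaves predicate names
-- untouched, so it preserves occurrence, polarity and the classes Ω±.

sF-occ : ∀ σ B {Z} → Occurs Z B → Occurs Z (substF σ B)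
sF-occ σ (atom X ts) here = here
sF-occ σ (A ⇒ B) (⇒ˡ o) = ⇒ˡ (sF-occ σ A o)
sF-occ σ (A ⇒ B) (⇒ʳ o) = ⇒ʳ (sF-occ σ B o)
sF-occ σ (∀ᵢ A) (∀ᵢo o) = ∀ᵢo (sF-occ (lift1 σ) A o)
sF-occ σ (∀ₚ n A) (∀ₚo o) = ∀ₚo (sF-occ σ A o)
sF-occ σ (μ n A ts) (μo o) = μo (sF-occ (liftσ n σ) A o)

sF-occ-inv : ∀ σ B {Z} → Occurs Z (substF σ B) → Occurs Z B
sF-occ-inv σ ⊥ᶠ ()
sF-occ-inv σ (atom X ts) here = here
sF-occ-inv σ (A ⇒ B) (⇒ˡ o) = ⇒ˡ (sF-occ-inv σ A o)
sF-occ-inv σ (A ⇒ B) (⇒ʳ o) = ⇒ʳ (sF-occ-inv σ B o)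
sF-occ-inv σ (∀ᵢ A) (∀ᵢo o) = ∀ᵢo (sF-occ-inv (lift1 σ) A o)
sF-occ-inv σ (∀ₚ n A) (∀ₚo o) = ∀ₚo (sF-occ-inv σ A o)
sF-occ-inv σ (μ n A ts) (μo o) = μo (sF-occ-inv (liftσ n σ) A o)

mutual
  sF-pos : ∀ σ B {Z} → Pos Z B → Pos Z (substF σ B)
  sF-pos σ B (pos-no ¬o) = pos-no (λ o → ¬o (sF-occ-inv σ B o))
  sF-pos σ (atom X ts) pos-atom = pos-atom
  sF-pos σ (A ⇒ B) (pos-⇒ a b) = pos-⇒ (sF-neg σ A a) (sF-pos σ B b)
  sF-pos σ (∀ᵢ A) (pos-∀ᵢ a) = pos-∀ᵢ (sF-pos (lift1 σ) A a)
  sF-pos σ (∀ₚ n A) (pos-∀ₚ a) = pos-∀ₚ (sF-pos σ A a)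
  sF-pos σ (μ n A ts) (pos-μ a) = pos-μ (sF-pos (liftσ n σ) A a)

  sF-neg : ∀ σ B {Z} → Neg Z B → Neg Z (substF σ B)
  sF-neg σ B (neg-no ¬o) = neg-no (λ o → ¬o (sF-occ-inv σ B o))
  sF-neg σ (A ⇒ B) (neg-⇒ a b) = neg-⇒ (sF-pos σ A a) (sF-neg σ B b)
  sF-neg σ (∀ᵢ A) (neg-∀ᵢ a) = neg-∀ᵢ (sF-neg (lift1 σ) A a)
  sF-neg σ (∀ₚ n A) (neg-∀ₚ a) = neg-∀ₚ (sF-neg σ A a)
  sF-neg σ (μ n A ts) (neg-μ a) = neg-μ (sF-neg (liftσ n σ) A a)

mutual
  sF-Ω⁺ : ∀ σ {B} → Ω⁺ B → Ω⁺ (substF σ B)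
  sF-Ω⁺ σ Ω⁺-atom = Ω⁺-atom
  sF-Ω⁺ σ Ω⁺-⊥ = Ω⁺-⊥
  sF-Ω⁺ σ (Ω⁺-⇒ a b) = Ω⁺-⇒ (sF-Ω⁻ σ a) (sF-Ω⁺ σ b)
  sF-Ω⁺ σ (Ω⁺-∀ᵢ a) = Ω⁺-∀ᵢ (sF-Ω⁺ (lift1 σ) a)
  sF-Ω⁺ σ (Ω⁺-∀ₚ a) = Ω⁺-∀ₚ (sF-Ω⁺ σ a)
  sF-Ω⁺ σ (Ω⁺-μ {n} {A} o p a) =
    Ω⁺-μ (sF-occ (liftσ n σ) A o) (sF-pos (liftσ n σ) A p) (sF-Ω⁺ (liftσ n σ) a)

  sF-Ω⁻ : ∀ σ {B} → Ω⁻ B → Ω⁻ (substF σ B)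
  sF-Ω⁻ σ Ω⁻-atom = Ω⁻-atom
  sF-Ω⁻ σ Ω⁻-⊥ = Ω⁻-⊥
  sF-Ω⁻ σ (Ω⁻-⇒ a b) = Ω⁻-⇒ (sF-Ω⁺ σ a) (sF-Ω⁻ σ b)
  sF-Ω⁻ σ (Ω⁻-∀ᵢ a) = Ω⁻-∀ᵢ (sF-Ω⁻ (lift1 σ) a)
  sF-Ω⁻ σ (Ω⁻-∀ₚ {n} {A} ¬o a) = Ω⁻-∀ₚ (λ o → ¬o (sF-occ-inv σ A o)) (sF-Ω⁻ σ a)

liftμ : ℕ → PSub → PSub
liftμ n ρ = liftInd n (liftPred psym n ρ)

data FreshOrWeakened (κb : Kind) (n : ℕ) : Kind → ℕ → ℕ → Set where
  fresh    : FreshOrWeakened κb n κb n 0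
  weakened : ∀ {κ m} k → FreshOrWeakened κb n κ m (wkR κb n κ m k)

freshOrWeakened : ∀ κb n κ m k → FreshOrWeakened κb n κ m k
freshOrWeakened κb n κ m k with sortView κb n κ m
freshOrWeakened κb n _ _ zero | same-sort = fresh
freshOrWeakened κb n _ _ (suc k) | same-sort =
  subst (FreshOrWeakened κb n κb n) (wkR-same κb n k) (weakened k)
freshOrWeakened κb n κ m k | other-sort e =
  subst (FreshOrWeakened κb n κ m) (wkR-other κb n κ m k e) (weakened k)

liftPred-fresh : ∀ κb n ρ → liftPred κb n ρ κb n 0 ≡ atom (pn κb n 0) (params n)
liftPred-fresh κb n ρ rewrite same-refl κb n = refl

liftPred-wkR : ∀ κb n ρ κ m j
             → liftPred κb n ρ κ m (wkR κb n κ m j) ≡ renP (wkR κb n) (ρ κ m j)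
liftPred-wkR κb n ρ κ m j with same κb n κ m
... | true = refl
... | false = refl

-- The name (κ , m , j) is kept by ρ when ρ
-- maps it to an atom on the same name, and avoided when it is mentioned by
-- no image except possibly its own; both hold for the name bound by μ or ∀ₚ.

Keep : PSub → Kind → (m : ℕ) → ℕ → Set
Keep ρ κ m j = Σ (Vec Term m) λ us → ρ κ m j ≡ atom (pn κ m j) us

Avoid : PSub → Kind → ℕ → ℕ → Set
Avoid ρ κ m j = ∀ κ' n k → Occurs (pn κ m j) (ρ κ' n k) → pn κ' n k ≡ pn κ m j

keep-liftInd : ∀ d ρ κ m j → Keep ρ κ m j → Keep (liftInd d ρ) κ m j
keep-liftInd d ρ κ m j (us , e) = substTs _ us , cong (substF _) e

keep-liftPred : ∀ κb n ρ κ m j → Keep ρ κ m j → Keep (liftPred κb n ρ) κ m (wkR κb n κ m j)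
keep-liftPred κb n ρ κ m j (us , e) =
  us , trans (liftPred-wkR κb n ρ κ m j) (cong (renP (wkR κb n)) e)

keep-liftμ : ∀ n ρ κ m j → Keep ρ κ m j → Keep (liftμ n ρ) κ m (wkR psym n κ m j)
keep-liftμ n ρ κ m j kp =
  keep-liftInd n (liftPred psym n ρ) κ m (wkR psym n κ m j) (keep-liftPred psym n ρ κ m j kp)

keep-fresh : ∀ κb n ρ → Keep (liftPred κb n ρ) κb n 0
keep-fresh κb n ρ = params n , liftPred-fresh κb n ρ

keep-μ-fresh : ∀ n ρ → Keep (liftμ n ρ) psym n 0
keep-μ-fresh n ρ = keep-liftInd n (liftPred psym n ρ) psym n 0 (keep-fresh psym n ρ)

occ-atom : ∀ {Z W ts} → Occurs Z (atom W ts) → Z ≡ W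
occ-atom here = refl

avoid-liftInd : ∀ d ρ κ m j → Avoid ρ κ m j → Avoid (liftInd d ρ) κ m j
avoid-liftInd d ρ κ m j av κ' n k o = av κ' n k (sF-occ-inv _ (ρ κ' n k) o)

avoid-liftPred : ∀ κb n ρ κ m j → Avoid ρ κ m j
               → Avoid (liftPred κb n ρ) κ m (wkR κb n κ m j)
avoid-liftPred κb n ρ κ m j av κ' n' k o with freshOrWeakened κb n κ' n' k
... | fresh = sym (occ-atom (subst (Occurs _) (liftPred-fresh κb n ρ) o))
... | weakened k'
  with ren-occ-inv (wkR κb n) (ρ κ' n' k') κ m (wkR κb n κ m j)
         (subst (Occurs _) (liftPred-wkR κb n ρ κ' n' k') o)
... | j' , e , o' with inj-wkR κb n κ m j j' e
... | refl with av κ' n' k' o'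
... | refl = refl

avoid-liftμ : ∀ n ρ κ m j → Avoid ρ κ m j → Avoid (liftμ n ρ) κ m (wkR psym n κ m j)
avoid-liftμ n ρ κ m j av =
  avoid-liftInd n (liftPred psym n ρ) κ m (wkR psym n κ m j) (avoid-liftPred psym n ρ κ m j av)

avoid-fresh : ∀ κb n ρ → Avoid (liftPred κb n ρ) κb n 0
avoid-fresh κb n ρ κ' n' k o with freshOrWeakened κb n κ' n' k
... | fresh = refl
... | weakened k'
  with ren-occ-inv (wkR κb n) (ρ κ' n' k') κb n 0
         (subst (Occurs _) (liftPred-wkR κb n ρ κ' n' k') o)
... | j , e , _ with trans (sym (wkR-same κb n j)) e
... | ()

avoid-μ-fresh : ∀ n ρ → Avoid (liftμ n ρ) psym n 0
avoid-μ-fresh n ρ = avoid-liftInd n (liftPred psym n ρ) psym n 0 (avoid-fresh psym n ρ)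

sub-occ : ∀ ρ A κ m j → Keep ρ κ m j → Occurs (pn κ m j) A → Occurs (pn κ m j) (substP ρ A)
sub-occ ρ (atom _ ts) κ m j (us , e) here =
  subst (λ F → Occurs (pn κ m j) (substF (inst ts) F)) (sym e) here
sub-occ ρ (A ⇒ B) κ m j kp (⇒ˡ o) = ⇒ˡ (sub-occ ρ A κ m j kp o)
sub-occ ρ (A ⇒ B) κ m j kp (⇒ʳ o) = ⇒ʳ (sub-occ ρ B κ m j kp o)
sub-occ ρ (∀ᵢ A) κ m j kp (∀ᵢo o) =
  ∀ᵢo (sub-occ (liftInd 1 ρ) A κ m j (keep-liftInd 1 ρ κ m j kp) o)
sub-occ ρ (∀ₚ n A) κ m j kp (∀ₚo o) =
  ∀ₚo (sub-occ (liftPred pvar n ρ) A κ m (wkR pvar n κ m j) (keep-liftPred pvar n ρ κ m j kp) o)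
sub-occ ρ (μ n A ts) κ m j kp (μo o) =
  μo (sub-occ (liftμ n ρ) A κ m (wkR psym n κ m j) (keep-liftμ n ρ κ m j kp) o)

sub-occ-inv : ∀ ρ A κ m j → Avoid ρ κ m j → Occurs (pn κ m j) (substP ρ A) → Occurs (pn κ m j) A
sub-occ-inv ρ ⊥ᶠ κ m j av ()
sub-occ-inv ρ (atom (pn κ' n k) ts) κ m j av o with av κ' n k (sF-occ-inv (inst ts) (ρ κ' n k) o)
... | refl = here
sub-occ-inv ρ (A ⇒ B) κ m j av (⇒ˡ o) = ⇒ˡ (sub-occ-inv ρ A κ m j av o)
sub-occ-inv ρ (A ⇒ B) κ m j av (⇒ʳ o) = ⇒ʳ (sub-occ-inv ρ B κ m j av o)
sub-occ-inv ρ (∀ᵢ A) κ m j av (∀ᵢo o) =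
  ∀ᵢo (sub-occ-inv (liftInd 1 ρ) A κ m j (avoid-liftInd 1 ρ κ m j av) o)
sub-occ-inv ρ (∀ₚ n A) κ m j av (∀ₚo o) =
  ∀ₚo (sub-occ-inv (liftPred pvar n ρ) A κ m (wkR pvar n κ m j) (avoid-liftPred pvar n ρ κ m j av) o)
sub-occ-inv ρ (μ n A ts) κ m j av (μo o) =
  μo (sub-occ-inv (liftμ n ρ) A κ m (wkR psym n κ m j) (avoid-liftμ n ρ κ m j av) o)

mutual
  sub-pos : ∀ ρ A κ m j → Keep ρ κ m j → Avoid ρ κ m j
          → Pos (pn κ m j) A → Pos (pn κ m j) (substP ρ A)
  sub-pos ρ A κ m j kp av (pos-no ¬o) = pos-no (λ o → ¬o (sub-occ-inv ρ A κ m j av o))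
  sub-pos ρ (atom _ ts) κ m j (us , e) av pos-atom =
    subst (λ F → Pos (pn κ m j) (substF (inst ts) F)) (sym e) pos-atom
  sub-pos ρ (A ⇒ B) κ m j kp av (pos-⇒ a b) =
    pos-⇒ (sub-neg ρ A κ m j kp av a) (sub-pos ρ B κ m j kp av b)
  sub-pos ρ (∀ᵢ A) κ m j kp av (pos-∀ᵢ a) =
    pos-∀ᵢ (sub-pos (liftInd 1 ρ) A κ m j (keep-liftInd 1 ρ κ m j kp) (avoid-liftInd 1 ρ κ m j av) a)
  sub-pos ρ (∀ₚ n A) κ m j kp av (pos-∀ₚ a) =
    pos-∀ₚ (sub-pos (liftPred pvar n ρ) A κ m (wkR pvar n κ m j)
      (keep-liftPred pvar n ρ κ m j kp) (avoid-liftPred pvar n ρ κ m j av) a)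
  sub-pos ρ (μ n A ts) κ m j kp av (pos-μ a) =
    pos-μ (sub-pos (liftμ n ρ) A κ m (wkR psym n κ m j)
      (keep-liftμ n ρ κ m j kp) (avoid-liftμ n ρ κ m j av) a)

  sub-neg : ∀ ρ A κ m j → Keep ρ κ m j → Avoid ρ κ m j
          → Neg (pn κ m j) A → Neg (pn κ m j) (substP ρ A)
  sub-neg ρ A κ m j kp av (neg-no ¬o) = neg-no (λ o → ¬o (sub-occ-inv ρ A κ m j av o))
  sub-neg ρ (A ⇒ B) κ m j kp av (neg-⇒ a b) =
    neg-⇒ (sub-pos ρ A κ m j kp av a) (sub-neg ρ B κ m j kp av b)
  sub-neg ρ (∀ᵢ A) κ m j kp av (neg-∀ᵢ a) =
    neg-∀ᵢ (sub-neg (liftInd 1 ρ) A κ m j (keep-liftInd 1 ρ κ m j kp) (avoid-liftInd 1 ρ κ m j av) a)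
  sub-neg ρ (∀ₚ n A) κ m j kp av (neg-∀ₚ a) =
    neg-∀ₚ (sub-neg (liftPred pvar n ρ) A κ m (wkR pvar n κ m j)
      (keep-liftPred pvar n ρ κ m j kp) (avoid-liftPred pvar n ρ κ m j av) a)
  sub-neg ρ (μ n A ts) κ m j kp av (neg-μ a) =
    neg-μ (sub-neg (liftμ n ρ) A κ m (wkR psym n κ m j)
      (keep-liftμ n ρ κ m j kp) (avoid-liftμ n ρ κ m j av) a)

IsAtom : Formula → Set
IsAtom F = Σ PName λ W → Σ (Vec Term (arity W)) λ ts → F ≡ atom W ts

AtomicExcept : PSub → PName → (Formula → Set) → Set
AtomicExcept ρ X P = ∀ κ n k → (pn κ n k ≡ X × P (ρ κ n k)) ⊎ IsAtom (ρ κ n k)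

-- Properties of formulas that survive the operations performed on the
-- images of a substitution when it is lifted past binders.
record Stable (P : Formula → Set) : Set where
  field
    substF-closed : ∀ σ {B} → P B → P (substF σ B)
    renP-closed   : ∀ r {B} → P B → P (renP r B)
open Stable

stable-Ω⁺ : Stable Ω⁺
stable-Ω⁺ = record { substF-closed = sF-Ω⁺ ; renP-closed = ren-Ω⁺ }

stable-Ω⁻ : Stable Ω⁻
stable-Ω⁻ = record { substF-closed = sF-Ω⁻ ; renP-closed = ren-Ω⁻ }

atomicExcept-liftInd : ∀ {P} d ρ X → Stable P → AtomicExcept ρ X P → AtomicExcept (liftInd d ρ) X P
atomicExcept-liftInd d ρ X st g κ n k with g κ n k
... | inj₁ (e , p) = inj₁ (e , substF-closed st _ p)
... | inj₂ (W , ts , e) = inj₂ (W , substTs _ ts , cong (substF _) e)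

atomicExcept-liftPred : ∀ {P} κb n ρ X → Stable P → AtomicExcept ρ X P
                      → AtomicExcept (liftPred κb n ρ) (wkN κb n X) P
atomicExcept-liftPred {P} κb n ρ X st g κ m k with freshOrWeakened κb n κ m k
... | fresh = inj₂ (pn κb n 0 , params n , liftPred-fresh κb n ρ)
... | weakened k' with g κ m k'
...   | inj₁ (e , p) =
  inj₁ (cong (wkN κb n) e , subst P (sym (liftPred-wkR κb n ρ κ m k')) (renP-closed st (wkR κb n) p))
...   | inj₂ (pn κw nw kw , ts , e) =
  inj₂ (pn κw nw (wkR κb n κw nw kw) , ts
       , trans (liftPred-wkR κb n ρ κ m k') (cong (renP (wkR κb n)) e))

atomicExcept-liftμ : ∀ {P} n ρ X → Stable P → AtomicExcept ρ X P
                   → AtomicExcept (liftμ n ρ) (wkN psym n X) P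
atomicExcept-liftμ n ρ X st g =
  atomicExcept-liftInd n (liftPred psym n ρ) (wkN psym n X) st (atomicExcept-liftPred psym n ρ X st g)

atomicExcept-single : ∀ (P : Formula → Set) X G → P G → AtomicExcept (single X G) X P
atomicExcept-single P (pn κ n k) G pG κ' n' k' with sortView κ n κ' n'
... | other-sort e rewrite e = inj₂ (pn κ' n' k' , params n' , refl)
... | same-sort with k ≟ k'
...   | yes refl rewrite same-refl κ n = inj₁ (refl , pG)
...   | no _ rewrite same-refl κ n = inj₂ (pn κ n k' , params n , refl)

atom-Ω⁺ : ∀ σ {F} → IsAtom F → Ω⁺ (substF σ F)
atom-Ω⁺ σ (W , ts , refl) = Ω⁺-atom

atom-Ω⁻ : ∀ σ {F} → IsAtom F → Ω⁻ (substF σ F)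
atom-Ω⁻ σ (W , ts , refl) = Ω⁻-atom

pos-⇒-inv : ∀ {X A B} → Pos X (A ⇒ B) → Neg X A × Pos X B
pos-⇒-inv (pos-no ¬o) = neg-no (λ o → ¬o (⇒ˡ o)) , pos-no (λ o → ¬o (⇒ʳ o))
pos-⇒-inv (pos-⇒ a b) = a , b

neg-⇒-inv : ∀ {X A B} → Neg X (A ⇒ B) → Pos X A × Neg X B
neg-⇒-inv (neg-no ¬o) = pos-no (λ o → ¬o (⇒ˡ o)) , neg-no (λ o → ¬o (⇒ʳ o))
neg-⇒-inv (neg-⇒ a b) = a , b

pos-∀ᵢ-inv : ∀ {X A} → Pos X (∀ᵢ A) → Pos X A
pos-∀ᵢ-inv (pos-no ¬o) = pos-no (λ o → ¬o (∀ᵢo o))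
pos-∀ᵢ-inv (pos-∀ᵢ a) = a

neg-∀ᵢ-inv : ∀ {X A} → Neg X (∀ᵢ A) → Neg X A
neg-∀ᵢ-inv (neg-no ¬o) = neg-no (λ o → ¬o (∀ᵢo o))
neg-∀ᵢ-inv (neg-∀ᵢ a) = a

pos-∀ₚ-inv : ∀ {X n A} → Pos X (∀ₚ n A) → Pos (wkN pvar n X) A
pos-∀ₚ-inv (pos-no ¬o) = pos-no (λ o → ¬o (∀ₚo o))
pos-∀ₚ-inv (pos-∀ₚ a) = a

neg-∀ₚ-inv : ∀ {X n A} → Neg X (∀ₚ n A) → Neg (wkN pvar n X) A
neg-∀ₚ-inv (neg-no ¬o) = neg-no (λ o → ¬o (∀ₚo o))
neg-∀ₚ-inv (neg-∀ₚ a) = a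

pos-μ-inv : ∀ {X n A ts} → Pos X (μ n A ts) → Pos (wkN psym n X) A
pos-μ-inv (pos-no ¬o) = pos-no (λ o → ¬o (μo o))
pos-μ-inv (pos-μ a) = a

neg-μ-inv : ∀ {X n A ts} → Neg X (μ n A ts) → Neg (wkN psym n X) A
neg-μ-inv (neg-no ¬o) = neg-no (λ o → ¬o (μo o))
neg-μ-inv (neg-μ a) = a

neg-atom : ∀ {X W ts} → Neg X (atom W ts) → W ≢ X
neg-atom (neg-no ¬o) refl = ¬o here

-- An atom on a name
-- other than X stays an atom; an atom on X occurs positively, so in the
-- positive cases it becomes an instance of the image of X, of the required
-- class, and in the negative cases it cannot arise.  The side conditions of
-- ∀ₚ and μ concern the fresh name, which the lifted substitution fixes.
mutual
  subst-Ω⁻-pos : ∀ ρ {X T} → AtomicExcept ρ X Ω⁻ → Ω⁻ T → Pos X T → Ω⁻ (substP ρ T)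
  subst-Ω⁻-pos ρ g Ω⁻-⊥ p = Ω⁻-⊥
  subst-Ω⁻-pos ρ g (Ω⁻-atom {pn κ n k} {ts}) p with g κ n k
  ... | inj₁ (_ , q) = sF-Ω⁻ (inst ts) q
  ... | inj₂ at = atom-Ω⁻ (inst ts) at
  subst-Ω⁻-pos ρ g (Ω⁻-⇒ a b) p =
    Ω⁻-⇒ (subst-Ω⁺-neg ρ g a (proj₁ (pos-⇒-inv p))) (subst-Ω⁻-pos ρ g b (proj₂ (pos-⇒-inv p)))
  subst-Ω⁻-pos ρ {X} g (Ω⁻-∀ᵢ a) p =
    Ω⁻-∀ᵢ (subst-Ω⁻-pos (liftInd 1 ρ) (atomicExcept-liftInd 1 ρ X stable-Ω⁻ g) a (pos-∀ᵢ-inv p))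
  subst-Ω⁻-pos ρ {X} g (Ω⁻-∀ₚ {n} {A} ¬o a) p =
    Ω⁻-∀ₚ (λ o → ¬o (sub-occ-inv ρ' A pvar n 0 (avoid-fresh pvar n ρ) o))
          (subst-Ω⁻-pos ρ' (atomicExcept-liftPred pvar n ρ X stable-Ω⁻ g) a (pos-∀ₚ-inv p))
    where
    ρ' : PSub
    ρ' = liftPred pvar n ρ

  subst-Ω⁻-neg : ∀ ρ {X T} → AtomicExcept ρ X Ω⁺ → Ω⁻ T → Neg X T → Ω⁻ (substP ρ T)
  subst-Ω⁻-neg ρ g Ω⁻-⊥ p = Ω⁻-⊥
  subst-Ω⁻-neg ρ g (Ω⁻-atom {pn κ n k} {ts}) p with g κ n k
  ... | inj₁ (e , _) = ⊥-elim (neg-atom p e)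
  ... | inj₂ at = atom-Ω⁻ (inst ts) at
  subst-Ω⁻-neg ρ g (Ω⁻-⇒ a b) p =
    Ω⁻-⇒ (subst-Ω⁺-pos ρ g a (proj₁ (neg-⇒-inv p))) (subst-Ω⁻-neg ρ g b (proj₂ (neg-⇒-inv p)))
  subst-Ω⁻-neg ρ {X} g (Ω⁻-∀ᵢ a) p =
    Ω⁻-∀ᵢ (subst-Ω⁻-neg (liftInd 1 ρ) (atomicExcept-liftInd 1 ρ X stable-Ω⁺ g) a (neg-∀ᵢ-inv p))
  subst-Ω⁻-neg ρ {X} g (Ω⁻-∀ₚ {n} {A} ¬o a) p =
    Ω⁻-∀ₚ (λ o → ¬o (sub-occ-inv ρ' A pvar n 0 (avoid-fresh pvar n ρ) o))
          (subst-Ω⁻-neg ρ' (atomicExcept-liftPred pvar n ρ X stable-Ω⁺ g) a (neg-∀ₚ-inv p))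
    where
    ρ' : PSub
    ρ' = liftPred pvar n ρ

  subst-Ω⁺-pos : ∀ ρ {X T} → AtomicExcept ρ X Ω⁺ → Ω⁺ T → Pos X T → Ω⁺ (substP ρ T)
  subst-Ω⁺-pos ρ g Ω⁺-⊥ p = Ω⁺-⊥
  subst-Ω⁺-pos ρ g (Ω⁺-atom {pn κ n k} {ts}) p with g κ n k
  ... | inj₁ (_ , q) = sF-Ω⁺ (inst ts) q
  ... | inj₂ at = atom-Ω⁺ (inst ts) at
  subst-Ω⁺-pos ρ g (Ω⁺-⇒ a b) p =
    Ω⁺-⇒ (subst-Ω⁻-neg ρ g a (proj₁ (pos-⇒-inv p))) (subst-Ω⁺-pos ρ g b (proj₂ (pos-⇒-inv p)))
  subst-Ω⁺-pos ρ {X} g (Ω⁺-∀ᵢ a) p =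
    Ω⁺-∀ᵢ (subst-Ω⁺-pos (liftInd 1 ρ) (atomicExcept-liftInd 1 ρ X stable-Ω⁺ g) a (pos-∀ᵢ-inv p))
  subst-Ω⁺-pos ρ {X} g (Ω⁺-∀ₚ {n} a) p =
    Ω⁺-∀ₚ (subst-Ω⁺-pos (liftPred pvar n ρ) (atomicExcept-liftPred pvar n ρ X stable-Ω⁺ g) a (pos-∀ₚ-inv p))
  subst-Ω⁺-pos ρ {X} g (Ω⁺-μ {n} {A} o q a) p =
    Ω⁺-μ (sub-occ ρ' A psym n 0 (keep-μ-fresh n ρ) o)
         (sub-pos ρ' A psym n 0 (keep-μ-fresh n ρ) (avoid-μ-fresh n ρ) q)
         (subst-Ω⁺-pos ρ' (atomicExcept-liftμ n ρ X stable-Ω⁺ g) a (pos-μ-inv p))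
    where
    ρ' : PSub
    ρ' = liftμ n ρ

  subst-Ω⁺-neg : ∀ ρ {X T} → AtomicExcept ρ X Ω⁻ → Ω⁺ T → Neg X T → Ω⁺ (substP ρ T)
  subst-Ω⁺-neg ρ g Ω⁺-⊥ p = Ω⁺-⊥
  subst-Ω⁺-neg ρ g (Ω⁺-atom {pn κ n k} {ts}) p with g κ n k
  ... | inj₁ (e , _) = ⊥-elim (neg-atom p e)
  ... | inj₂ at = atom-Ω⁺ (inst ts) at
  subst-Ω⁺-neg ρ g (Ω⁺-⇒ a b) p =
    Ω⁺-⇒ (subst-Ω⁻-pos ρ g a (proj₁ (neg-⇒-inv p))) (subst-Ω⁺-neg ρ g b (proj₂ (neg-⇒-inv p)))
  subst-Ω⁺-neg ρ {X} g (Ω⁺-∀ᵢ a) p =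
    Ω⁺-∀ᵢ (subst-Ω⁺-neg (liftInd 1 ρ) (atomicExcept-liftInd 1 ρ X stable-Ω⁻ g) a (neg-∀ᵢ-inv p))
  subst-Ω⁺-neg ρ {X} g (Ω⁺-∀ₚ {n} a) p =
    Ω⁺-∀ₚ (subst-Ω⁺-neg (liftPred pvar n ρ) (atomicExcept-liftPred pvar n ρ X stable-Ω⁻ g) a (neg-∀ₚ-inv p))
  subst-Ω⁺-neg ρ {X} g (Ω⁺-μ {n} {A} o q a) p =
    Ω⁺-μ (sub-occ ρ' A psym n 0 (keep-μ-fresh n ρ) o)
         (sub-pos ρ' A psym n 0 (keep-μ-fresh n ρ) (avoid-μ-fresh n ρ) q)
         (subst-Ω⁺-neg ρ' (atomicExcept-liftμ n ρ X stable-Ω⁻ g) a (neg-μ-inv p))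
    where
    ρ' : PSub
    ρ' = liftμ n ρ

-- Part (3), for every substitution: substP preserves the outermost
-- constructor of every non-atomic formula, and atoms are in both classes.
-- The side conditions of μ come from well-formedness of T; that of ∀ₚ
-- transfers back because the fresh name is kept by the lifted substitution.
mutual
  reflect-Ω⁺ : ∀ ρ {T} → WF T → Ω⁺ (substP ρ T) → Ω⁺ T
  reflect-Ω⁺ ρ wf-⊥ _ = Ω⁺-⊥
  reflect-Ω⁺ ρ wf-atom _ = Ω⁺-atom
  reflect-Ω⁺ ρ (wf-⇒ a b) (Ω⁺-⇒ x y) = Ω⁺-⇒ (reflect-Ω⁻ ρ a x) (reflect-Ω⁺ ρ b y)
  reflect-Ω⁺ ρ (wf-∀ᵢ a) (Ω⁺-∀ᵢ x) = Ω⁺-∀ᵢ (reflect-Ω⁺ (liftInd 1 ρ) a x)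
  reflect-Ω⁺ ρ (wf-∀ₚ {n} a) (Ω⁺-∀ₚ x) = Ω⁺-∀ₚ (reflect-Ω⁺ (liftPred pvar n ρ) a x)
  reflect-Ω⁺ ρ (wf-μ {n} o p a) (Ω⁺-μ _ _ x) = Ω⁺-μ o p (reflect-Ω⁺ (liftμ n ρ) a x)

  reflect-Ω⁻ : ∀ ρ {T} → WF T → Ω⁻ (substP ρ T) → Ω⁻ T
  reflect-Ω⁻ ρ wf-⊥ _ = Ω⁻-⊥
  reflect-Ω⁻ ρ wf-atom _ = Ω⁻-atom
  reflect-Ω⁻ ρ (wf-⇒ a b) (Ω⁻-⇒ x y) = Ω⁻-⇒ (reflect-Ω⁺ ρ a x) (reflect-Ω⁻ ρ b y)
  reflect-Ω⁻ ρ (wf-∀ᵢ a) (Ω⁻-∀ᵢ x) = Ω⁻-∀ᵢ (reflect-Ω⁻ (liftInd 1 ρ) a x)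
  reflect-Ω⁻ ρ (wf-∀ₚ {n} {A} a) (Ω⁻-∀ₚ ¬o x) =
    Ω⁻-∀ₚ (λ o → ¬o (sub-occ (liftPred pvar n ρ) A pvar n 0 (keep-fresh pvar n ρ) o))
          (reflect-Ω⁻ (liftPred pvar n ρ) a x)
  reflect-Ω⁻ ρ (wf-μ _ _ _) ()

lemma5p1 : ((X : PName) (T T' : Formula) → Ω⁻ T → Ω⁻ T' → Pos X T → Ω⁻ (T [ T' / X ]))
    × ((X : PName) (T T' : Formula) → Ω⁻ T → Ω⁺ T' → Neg X T → Ω⁻ (T [ T' / X ]))
    × ((X : PName) (T T' : Formula) → Ω⁺ T → Ω⁺ T' → Pos X T → Ω⁺ (T [ T' / X ]))
    × ((X : PName) (T T' : Formula) → Ω⁺ T → Ω⁻ T' → Neg X T → Ω⁺ (T [ T' / X ]))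
    × ((X : PName) (T F : Formula) → WF T → WF F → Ω⁺ (T [ F / X ]) → Ω⁺ T)
    × ((X : PName) (T F : Formula) → WF T → WF F → Ω⁻ (T [ F / X ]) → Ω⁻ T)
lemma5p1 =
    (λ X T T' t t' p → subst-Ω⁻-pos (single X T') (atomicExcept-single Ω⁻ X T' t') t p)
  , (λ X T T' t t' p → subst-Ω⁻-neg (single X T') (atomicExcept-single Ω⁺ X T' t') t p)
  , (λ X T T' t t' p → subst-Ω⁺-pos (single X T') (atomicExcept-single Ω⁺ X T' t') t p)
  , (λ X T T' t t' p → subst-Ω⁺-neg (single X T') (atomicExcept-single Ω⁻ X T' t') t p)
  , (λ X T F wfT _ x → reflect-Ω⁺ (single X F) wfT x)
  , (λ X T F wfT _ x → reflect-Ω⁻ (single X F) wfT x)
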